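{- Let $P$ be a finite poset, let $Q$ be a good fracturing of $P$, and let $\mathcal{B}$ be the collection of all betrayal functions $\beta$ for $Q$ such that $\mathrm{Supp}_\beta(Q)\neq\emptyset$. Then $\bigcap_{\beta\in\mathcal{B}}\mathrm{Supp}_\beta(Q)\neq\emptyset$.
   Context: Let $I$ be the underlying set of $P$. A set composition $\Phi=\Phi_1|\cdots|\Phi_m\models I$ is an ordered partition into nonempty blocks; $i<_\Phi j$ means $i$'s block precedes $j$'s. For a grounded set family $(\mathcal{F},I)$ let $\mathcal{F}_i=\{A\cap\Phi_i:A\in\mathcal{F},\ A\cap\Phi_j=\emptyset\ \forall j<i\}$ and $\mu_\Phi\Delta_\Phi(\mathcal{F})=\{X_1\cup\cdots\cup X_m:X_i\in\mathcal{F}_i\}$. $J(P)$ is the family of order ideals of $P$. A fracturing of $P$ is a poset $Q$ on a subset of $P$ that is a disjoint union of induced subposets of $P$ ($x<_Qy$ iff $x,y$ in the same summand and $x<_Py$). $\mathrm{Supp}(Q)=\{\Phi\models I:\mu_\Phi\Delta_\Phi(J(P))=J(Q)\}$; $Q$ is good if $\mathrm{Supp}(Q)\neq\emptyset$. A betrayal function for $Q$ is a map $\beta:P\setminus Q\to P$ with $\beta(b)<_Pb$ for all $b\in P\setminus Q$, and $\mathrm{Supp}_\beta(Q)=\{\Phi\in\mathrm{Supp}(Q):\beta(b)<_\Phi b\ \forall b\in P\setminus Q\}$. -}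

module Defs where

open import Data.Nat using (ℕ)
open import Data.Fin using (Fin; _<_; _≟_)
open import Data.Fin.Subset using (Subset; _∈_; _∉_; _∩_; _∪_; ⊥; ⋃)
open import Data.Vec using (tabulate)
open import Data.List using (List)
import Data.List as List
open import Data.Product using (Σ; _×_; ∃)
open import Function.Bundles using (_⇔_)
open import Relation.Binary.PropositionalEquality using (_≡_; _≢_)
open import Relation.Binary.Structures using (IsDecPartialOrder)
open import Relation.Nullary.Decidable using (⌊_⌋)

record FinPoset (n : ℕ) : Set₁ where
  field
    _≤P_ : Fin n → Fin n → Set
    isDecPartialOrder : IsDecPartialOrder _≡_ _≤P_
  _<P_ : Fin n → Fin n → Set
  x <P y = (x ≤P y) × (x ≢ y)
open FinPoset public

-- A set composition Φ = Φ₁|⋯|Φₘ ⊨ Fin n, encoded by the surjective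
-- block-index map  blk : Fin n → Fin m  (x ∈ Φᵢ  iff  blk x ≡ i).
record SetComp (n : ℕ) : Set where
  field
    m    : ℕ
    blk  : Fin n → Fin m
    surj : ∀ (i : Fin m) → ∃ λ x → blk x ≡ i
open SetComp public

block : ∀ {n} (Φ : SetComp n) → Fin (m Φ) → Subset n
block Φ i = tabulate (λ x → ⌊ blk Φ x ≟ i ⌋)

_<[_]_ : ∀ {n} → Fin n → SetComp n → Fin n → Set
i <[ Φ ] j = blk Φ i < blk Φ j

Family : ℕ → Set₁
Family n = Subset n → Set

restrictFamily : ∀ {n} (Φ : SetComp n) (F : Family n) (i : Fin (m Φ)) → Family n
restrictFamily Φ F i Y =
  Σ (Subset _) λ A → F A × (∀ (j : Fin (m Φ)) → j < i → A ∩ block Φ j ≡ ⊥)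
                         × (Y ≡ A ∩ block Φ i)

μΔ : ∀ {n} (Φ : SetComp n) (F : Family n) → Family n
μΔ Φ F X =
  Σ (Fin (m Φ) → Subset _) λ Xs →
    (∀ i → restrictFamily Φ F i (Xs i)) × (X ≡ ⋃ (List.tabulate Xs))

_≐_ : ∀ {n} → Family n → Family n → Set
F ≐ G = ∀ X → (F X ⇔ G X)

J : ∀ {n} → FinPoset n → Family n
J P X = ∀ x y → y ∈ X → _≤P_ P x y → x ∈ X

-- A fracturing Q of P: an underlying subset S ⊆ I together with a labelling
-- of its elements by summands; x ≤_Q y iff x,y ∈ S, same summand, x ≤_P y.
-- (Every poset on a subset of P that is a disjoint union of induced
-- subposets arises this way; labels of elements outside S are irrelevant.)
record Fracturing {n : ℕ} (P : FinPoset n) : Set where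
  field
    S       : Subset n
    summand : Fin n → ℕ
open Fracturing public

_≤Q[_]_ : ∀ {n} {P : FinPoset n} → Fin n → Fracturing P → Fin n → Set
_≤Q[_]_ {P = P} x Q y = (x ∈ S Q) × (y ∈ S Q) × (summand Q x ≡ summand Q y) × _≤P_ P x y

JQ : ∀ {n} {P : FinPoset n} → Fracturing P → Family n
JQ Q X = (∀ x → x ∈ X → x ∈ S Q) × (∀ x y → y ∈ X → x ≤Q[ Q ] y → x ∈ X)

Supp : ∀ {n} {P : FinPoset n} → Fracturing P → SetComp n → Set
Supp {P = P} Q Φ = μΔ Φ (J P) ≐ JQ Q

Good : ∀ {n} {P : FinPoset n} → Fracturing P → Set
Good Q = ∃ λ Φ → Supp Q Φ

record Betrayal {n : ℕ} {P : FinPoset n} (Q : Fracturing P) : Set where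
  field
    β    : (b : Fin n) → b ∉ S Q → Fin n
    β<   : (b : Fin n) (h : b ∉ S Q) → _<P_ P (β b h) b
open Betrayal public

Suppβ : ∀ {n} {P : FinPoset n} (Q : Fracturing P) → Betrayal Q → SetComp n → Set
Suppβ Q bt Φ = Supp Q Φ × (∀ b (h : b ∉ S Q) → β bt b h <[ Φ ] b)

{-# OPTIONS --safe #-}
-- A set composition Φ lies in Supp(Q) iff, writing r for its block index, the
-- sets X with  (x ∈ X, y ≤ x ⇒ r x ≤ r y)  and  (x ∈ X, y ≤ x, r y = r x ⇒ y ∈ X)
-- are exactly the order ideals of Q; this depends only on the preorder r induces.
-- Given Ψ ∈ Supp(Q), rank the elements of Q by their Ψ-block and put every element
-- of P ∖ Q after all of them, ranked by the number of elements below it. Such a b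
-- is never in an ideal of Q, and Ψ already forces it to lie strictly above some
-- element, so the new ranking still describes J(Q); and since it strictly increases
-- along P into P ∖ Q, we get β(b) <_Φ b for every betrayal function β.
module Submission where

open import Data.Nat as ℕ using (ℕ; zero; suc; _+_; _≤_; _<_; z≤n; s≤s)
import Data.Nat.Properties as ℕ
open import Data.Fin as Fin using (Fin; toℕ; fromℕ<)
import Data.Fin.Properties as Fin
open import Data.Fin.Subset using (Subset; _∈_; _∉_; _∩_; ⊥; ⋃; ∣_∣)
open import Data.Fin.Subset.Properties
  using (_∈?_; x∈p∩q⁺; x∈p∩q⁻; x∈p∪q⁺; x∈p∪q⁻; ∉⊥; Empty-unique; ⊆-antisym; p⊂q⇒∣p∣<∣q∣)
open import Data.Vec using (tabulate)
open import Data.Vec.Properties using (lookup∘tabulate; lookup⇒[]=; []=⇒lookup)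
import Data.List as List
open import Data.List.Extrema.Nat using (max; xs≤max)
open import Data.List.Relation.Unary.All.Properties using (tabulate⁻)
open import Data.Bool.Properties using (T-≡)
open import Data.Empty using () renaming (⊥ to Empty)
open import Data.Product using (Σ; _×_; _,_; ∃; proj₁; proj₂)
open import Data.Sum using (inj₁; inj₂)
open import Function using (_∘_; _⇔_; mk⇔; Equivalence)
import Function.Properties.Equivalence as ⇔
open import Level using (Level)
open import Relation.Nullary using (Dec; yes; no; contradiction)
open import Relation.Nullary.Decidable using (⌊_⌋; toWitness; fromWitness; toSum; _×-dec_)
open import Relation.Unary using (Pred; Decidable)
open import Relation.Binary.PropositionalEquality using (_≡_; refl; sym; trans; subst; subst₂; cong)
open import Relation.Binary.Structures using (IsDecPartialOrder)
open import Defs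

private
  variable
    ℓ : Level
    n : ℕ

module _ {P : Pred (Fin n) ℓ} (P? : Decidable P) where

  select : Subset n
  select = tabulate (λ x → ⌊ P? x ⌋)

  ∈-select⁺ : ∀ {x} → P x → x ∈ select
  ∈-select⁺ {x} px =
    lookup⇒[]= x select (trans (lookup∘tabulate _ x) (Equivalence.to T-≡ (fromWitness px)))

  ∈-select⁻ : ∀ {x} → x ∈ select → P x
  ∈-select⁻ {x} x∈ =
    toWitness (Equivalence.from T-≡ (trans (sym (lookup∘tabulate _ x)) ([]=⇒lookup x∈)))

∈-⋃-tabulate⁺ : ∀ {k} (Xs : Fin k → Subset n) {x} i → x ∈ Xs i → x ∈ ⋃ (List.tabulate Xs)
∈-⋃-tabulate⁺ Xs Fin.zero    x∈ = x∈p∪q⁺ (inj₁ x∈)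
∈-⋃-tabulate⁺ Xs (Fin.suc i) x∈ = x∈p∪q⁺ (inj₂ (∈-⋃-tabulate⁺ (Xs ∘ Fin.suc) i x∈))

∈-⋃-tabulate⁻ : ∀ {k} (Xs : Fin k → Subset n) {x} → x ∈ ⋃ (List.tabulate Xs) → ∃ λ i → x ∈ Xs i
∈-⋃-tabulate⁻ {k = zero}  Xs x∈ = contradiction x∈ ∉⊥
∈-⋃-tabulate⁻ {k = suc k} Xs x∈ with x∈p∪q⁻ (Xs Fin.zero) _ x∈
... | inj₁ x∈₀ = Fin.zero , x∈₀
... | inj₂ x∈ᵣ with ∈-⋃-tabulate⁻ (Xs ∘ Fin.suc) x∈ᵣ
...   | i , x∈ᵢ = Fin.suc i , x∈ᵢ

∈-block⁺ : (Φ : SetComp n) {i : Fin (m Φ)} {x : Fin n} → blk Φ x ≡ i → x ∈ block Φ i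
∈-block⁺ Φ {i} = ∈-select⁺ (λ x → blk Φ x Fin.≟ i)

∈-block⁻ : (Φ : SetComp n) {i : Fin (m Φ)} {x : Fin n} → x ∈ block Φ i → blk Φ x ≡ i
∈-block⁻ Φ {i} = ∈-select⁻ (λ x → blk Φ x Fin.≟ i)

blockIndex : SetComp n → Fin n → ℕ
blockIndex Φ = toℕ ∘ blk Φ

SameOrder : (r s : Fin n → ℕ) → Set
SameOrder r s = ∀ x y → r x ≤ r y ⇔ s x ≤ s y

module _ {r s : Fin n → ℕ} (r∼s : SameOrder r s) where

  SameOrder-≡ : ∀ {x y} → s x ≡ s y → r x ≡ r y
  SameOrder-≡ {x} {y} e =
    ℕ.≤-antisym (Equivalence.from (r∼s x y) (ℕ.≤-reflexive e))
                (Equivalence.from (r∼s y x) (ℕ.≤-reflexive (sym e)))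

  SameOrder-< : ∀ {x y} → s x < s y → r x < r y
  SameOrder-< {x} {y} lt = ℕ.≰⇒> (ℕ.<⇒≱ lt ∘ Equivalence.to (r∼s y x))

-- rank t counts the values below t attained by r, so rank ∘ r squeezes r onto an
-- initial segment of ℕ without changing the order it induces.
module Compression (r : Fin n → ℕ) where

  attained? : ∀ t → Dec (∃ λ x → r x ≡ t)
  attained? t = Fin.any? (λ x → r x ℕ.≟ t)

  rank : ℕ → ℕ
  rank zero = zero
  rank (suc t) with attained? t
  ... | yes _ = suc (rank t)
  ... | no _  = rank t

  rank-≤-suc : ∀ t → rank t ≤ rank (suc t)
  rank-≤-suc t with attained? t
  ... | yes _ = ℕ.n≤1+n (rank t)
  ... | no _  = ℕ.≤-refl

  rank-mono : ∀ {t u} → t ≤ u → rank t ≤ rank u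
  rank-mono {u = zero} z≤n = ℕ.≤-refl
  rank-mono {t} {suc u} t≤1+u with ℕ.m≤n⇒m<n∨m≡n t≤1+u
  ... | inj₁ (s≤s t≤u) = ℕ.≤-trans (rank-mono t≤u) (rank-≤-suc u)
  ... | inj₂ refl      = ℕ.≤-refl

  rank-<-suc : ∀ x → rank (r x) < rank (suc (r x))
  rank-<-suc x with attained? (r x)
  ... | yes _ = ℕ.≤-refl
  ... | no ¬a = contradiction (x , refl) ¬a

  rank-strict : ∀ {x t} → r x < t → rank (r x) < rank t
  rank-strict {x} r<t = ℕ.<-≤-trans (rank-<-suc x) (rank-mono r<t)

  rank-hits : ∀ {i} t → i < rank t → ∃ λ x → rank (r x) ≡ i
  rank-hits (suc t) i<rank with attained? t
  ... | no _ = rank-hits t i<rank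
  ... | yes (x , rx≡t) with ℕ.m≤n⇒m<n∨m≡n (ℕ.≤-pred i<rank)
  ...   | inj₁ i<rankt = rank-hits t i<rankt
  ...   | inj₂ i≡rankt = x , trans (cong rank rx≡t) (sym i≡rankt)

  bound : ℕ
  bound = suc (max 0 (List.tabulate r))

  r<bound : ∀ x → r x < bound
  r<bound x = s≤s (tabulate⁻ (xs≤max 0 (List.tabulate r)) x)

  composition : SetComp n
  composition = record
    { m    = rank bound
    ; blk  = λ x → fromℕ< (rank-strict (r<bound x))
    ; surj = λ i → let x , e = rank-hits bound (Fin.toℕ<n i) in
                   x , Fin.toℕ-injective (trans (Fin.toℕ-fromℕ< _) e)
    }

  blockIndex≡rank : ∀ x → blockIndex composition x ≡ rank (r x)
  blockIndex≡rank x = Fin.toℕ-fromℕ< (rank-strict (r<bound x))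

  sameOrder : SameOrder (blockIndex composition) r
  sameOrder x y = mk⇔
    (λ bx≤by → ℕ.≮⇒≥ λ ry<rx → ℕ.<⇒≱ (rank-strict ry<rx) (rank-of bx≤by))
    (λ rx≤ry → subst₂ _≤_ (sym (blockIndex≡rank x)) (sym (blockIndex≡rank y)) (rank-mono rx≤ry))
    where
    rank-of : blockIndex composition x ≤ blockIndex composition y → rank (r x) ≤ rank (r y)
    rank-of = subst₂ _≤_ (blockIndex≡rank x) (blockIndex≡rank y)

compress : (r : Fin n → ℕ) → ∃ λ (Φ : SetComp n) → SameOrder (blockIndex Φ) r
compress r = composition , sameOrder
  where open Compression r

module _ (P : FinPoset n) where
  private
    _⊑_ : Fin n → Fin n → Set
    _⊑_ = _≤P_ P
    open module ≤P = IsDecPartialOrder (isDecPartialOrder P) using () renaming (_≤?_ to _⊑?_)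

  height : Fin n → ℕ
  height x = ∣ select (_⊑? x) ∣

  height-strict : ∀ {a b} → _<P_ P a b → height a < height b
  height-strict {a} {b} (a⊑b , a≢b) = p⊂q⇒∣p∣<∣q∣
    ( (λ y⊑a → ∈-select⁺ (_⊑? b) (≤P.trans (∈-select⁻ (_⊑? a) y⊑a) a⊑b))
    , b , ∈-select⁺ (_⊑? b) ≤P.refl
    , λ b⊑a → a≢b (≤P.antisym a⊑b (∈-select⁻ (_⊑? a) b⊑a)) )

  record RankIdeal (r : Fin n → ℕ) (X : Subset n) : Set where
    field
      antitone    : ∀ {x y} → x ∈ X → y ⊑ x → r x ≤ r y
      levelClosed : ∀ {x y} → x ∈ X → y ⊑ x → r y ≡ r x → y ∈ X
  open RankIdeal public

  RankIdeal-resp : ∀ {r s} → SameOrder r s → ∀ {X} → RankIdeal r X → RankIdeal s X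
  RankIdeal-resp {r} {s} r∼s ideal = record
    { antitone    = λ x∈ y⊑x → Equivalence.to (r∼s _ _) (antitone ideal x∈ y⊑x)
    ; levelClosed = λ x∈ y⊑x sy≡sx → levelClosed ideal x∈ y⊑x (SameOrder-≡ r∼s sy≡sx)
    }

  module _ (Φ : SetComp n) where

    μΔ-J⇒RankIdeal : ∀ {X} → μΔ Φ (J P) X → RankIdeal (blockIndex Φ) X
    μΔ-J⇒RankIdeal {X} (Xs , pieces , X≡⋃) = record { antitone = antitone′ ; levelClosed = levelClosed′ }
      where
      piece : ∀ {x} → x ∈ X → Σ (Subset n) λ A → x ∈ A × J P A
                × (∀ j → j Fin.< blk Φ x → A ∩ block Φ j ≡ ⊥)
                × (∀ {y} → y ∈ A ∩ block Φ (blk Φ x) → y ∈ X)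
      piece {x} x∈X with ∈-⋃-tabulate⁻ Xs (subst (x ∈_) X≡⋃ x∈X)
      ... | i , x∈Xsᵢ with pieces i
      ...   | A , ideal , earlier , Xsᵢ≡ with x∈p∩q⁻ A (block Φ i) (subst (x ∈_) Xsᵢ≡ x∈Xsᵢ)
      ...     | x∈A , x∈Φᵢ with ∈-block⁻ Φ x∈Φᵢ
      ...       | refl = A , x∈A , ideal , earlier
                       , λ y∈ → subst (_ ∈_) (sym X≡⋃) (∈-⋃-tabulate⁺ Xs i (subst (_ ∈_) (sym Xsᵢ≡) y∈))

      antitone′ : ∀ {x y} → x ∈ X → y ⊑ x → blockIndex Φ x ≤ blockIndex Φ y
      antitone′ {x} {y} x∈X y⊑x with piece x∈X
      ... | A , x∈A , ideal , earlier , _ = ℕ.≮⇒≥ λ by<bx →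
        ∉⊥ (subst (y ∈_) (earlier (blk Φ y) by<bx) (x∈p∩q⁺ (ideal y x x∈A y⊑x , ∈-block⁺ Φ refl)))

      levelClosed′ : ∀ {x y} → x ∈ X → y ⊑ x → blockIndex Φ y ≡ blockIndex Φ x → y ∈ X
      levelClosed′ {x} {y} x∈X y⊑x by≡bx with piece x∈X
      ... | A , x∈A , ideal , _ , ⊆X =
        ⊆X (x∈p∩q⁺ (ideal y x x∈A y⊑x , ∈-block⁺ Φ (Fin.toℕ-injective by≡bx)))

    RankIdeal⇒μΔ-J : ∀ {X} → RankIdeal (blockIndex Φ) X → μΔ Φ (J P) X
    RankIdeal⇒μΔ-J {X} ideal = Piece , (λ i → Down i , Down-ideal i , earlier i , refl) , X≡⋃
      where
      Below : Fin (m Φ) → Fin n → Set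
      Below i y = ∃ λ x → x ∈ X × blk Φ x ≡ i × y ⊑ x

      Down : Fin (m Φ) → Subset n
      Down i = select (λ y → Fin.any? (λ x → (x ∈? X) ×-dec (blk Φ x Fin.≟ i) ×-dec (y ⊑? x)))

      Down⁺ : ∀ {i y} → Below i y → y ∈ Down i
      Down⁺ = ∈-select⁺ _

      Down⁻ : ∀ {i y} → y ∈ Down i → Below i y
      Down⁻ = ∈-select⁻ _

      Piece : Fin (m Φ) → Subset n
      Piece i = Down i ∩ block Φ i

      Down-ideal : ∀ i → J P (Down i)
      Down-ideal i z y y∈ z⊑y with Down⁻ y∈
      ... | x , x∈X , bx≡i , y⊑x = Down⁺ (x , x∈X , bx≡i , ≤P.trans z⊑y y⊑x)

      earlier : ∀ i j → j Fin.< i → Down i ∩ block Φ j ≡ ⊥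
      earlier i j j<i = Empty-unique λ (y , y∈) → disjoint (x∈p∩q⁻ (Down i) (block Φ j) y∈)
        where
        disjoint : ∀ {y} → y ∈ Down i × y ∈ block Φ j → Empty
        disjoint (y∈Down , y∈Φⱼ) with Down⁻ y∈Down | ∈-block⁻ Φ y∈Φⱼ
        ... | x , x∈X , refl , y⊑x | refl = ℕ.<⇒≱ j<i (antitone ideal x∈X y⊑x)

      X≡⋃ : X ≡ ⋃ (List.tabulate Piece)
      X≡⋃ = ⊆-antisym
        (λ x∈X → ∈-⋃-tabulate⁺ Piece _ (x∈p∩q⁺ (Down⁺ (_ , x∈X , refl , ≤P.refl) , ∈-block⁺ Φ refl)))
        (λ x∈⋃ → let i , x∈ᵢ = ∈-⋃-tabulate⁻ Piece x∈⋃ ; x∈Down , x∈Φᵢ = x∈p∩q⁻ (Down i) _ x∈ᵢ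
                     z , z∈X , bz≡i , x⊑z = Down⁻ x∈Down
                 in levelClosed ideal z∈X x⊑z (cong toℕ (trans (∈-block⁻ Φ x∈Φᵢ) (sym bz≡i))))

    μΔ-J⇔RankIdeal : ∀ X → μΔ Φ (J P) X ⇔ RankIdeal (blockIndex Φ) X
    μΔ-J⇔RankIdeal X = mk⇔ μΔ-J⇒RankIdeal RankIdeal⇒μΔ-J

  RankIdeal-cong : ∀ {r s} → SameOrder r s → ∀ X → RankIdeal r X ⇔ RankIdeal s X
  RankIdeal-cong r∼s X = mk⇔ (RankIdeal-resp r∼s) (RankIdeal-resp (λ x y → ⇔.sym (r∼s x y)))

module _ {P : FinPoset n} (Q : Fracturing P) where
  private
    _⊑_ : Fin n → Fin n → Set
    _⊑_ = _≤P_ P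
    open module ≤P = IsDecPartialOrder (isDecPartialOrder P) using () renaming (_≤?_ to _⊑?_)

  _≤Q?_ : ∀ x y → Dec (x ≤Q[ Q ] y)
  x ≤Q? y = (x ∈? S Q) ×-dec (y ∈? S Q) ×-dec (summand Q x ℕ.≟ summand Q y) ×-dec (x ⊑? y)

  ≤Q-refl : ∀ {x} → x ∈ S Q → x ≤Q[ Q ] x
  ≤Q-refl x∈S = x∈S , x∈S , refl , ≤P.refl

  ≤Q-trans : ∀ {x y z} → x ≤Q[ Q ] y → y ≤Q[ Q ] z → x ≤Q[ Q ] z
  ≤Q-trans (x∈S , _ , sx≡sy , x⊑y) (_ , z∈S , sy≡sz , y⊑z) = x∈S , z∈S , trans sx≡sy sy≡sz , ≤P.trans x⊑y y⊑z

  ↓Q : Fin n → Subset n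
  ↓Q x = select (_≤Q? x)

  ↓Q-JQ : ∀ x → JQ Q (↓Q x)
  ↓Q-JQ x = (λ z z∈ → proj₁ (∈-select⁻ (_≤Q? x) z∈))
          , (λ z y y∈ z≤y → ∈-select⁺ (_≤Q? x) (≤Q-trans z≤y (∈-select⁻ (_≤Q? x) y∈)))

  module Support (Ψ : SetComp n) (suppΨ : Supp Q Ψ) where
    private
      ρ : Fin n → ℕ
      ρ = blockIndex Ψ

    JQ⇔RankIdeal : ∀ X → JQ Q X ⇔ RankIdeal P ρ X
    JQ⇔RankIdeal X = ⇔.trans (⇔.sym (suppΨ X)) (μΔ-J⇔RankIdeal P Ψ X)

    ↓Q-RankIdeal : ∀ x → RankIdeal P ρ (↓Q x)
    ↓Q-RankIdeal x = Equivalence.to (JQ⇔RankIdeal (↓Q x)) (↓Q-JQ x)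

    antitone-S : ∀ {x y} → x ∈ S Q → y ⊑ x → ρ x ≤ ρ y
    antitone-S x∈S = antitone (↓Q-RankIdeal _) (∈-select⁺ (_≤Q? _) (≤Q-refl x∈S))

    sameBlock⇒≤Q : ∀ {x y} → x ∈ S Q → y ⊑ x → ρ y ≡ ρ x → y ≤Q[ Q ] x
    sameBlock⇒≤Q x∈S y⊑x ρy≡ρx = ∈-select⁻ (_≤Q? _)
      (levelClosed (↓Q-RankIdeal _) (∈-select⁺ (_≤Q? _) (≤Q-refl x∈S)) y⊑x ρy≡ρx)

    Slice : Fin n → Subset n
    Slice x = select (λ z → (z ⊑? x) ×-dec (ρ z ℕ.≟ ρ x))

    x∈Slice : ∀ x → x ∈ Slice x
    x∈Slice x = ∈-select⁺ _ (≤P.refl , refl)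

    Slice-JQ : ∀ {x} → (∀ {u} → u ⊑ x → ρ x ≤ ρ u) → JQ Q (Slice x)
    Slice-JQ {x} minimal = Equivalence.from (JQ⇔RankIdeal (Slice x)) (record
      { antitone    = λ z∈ u⊑z → let z⊑x , ρz≡ρx = ∈-select⁻ _ z∈ in
                                 subst (_≤ _) (sym ρz≡ρx) (minimal (≤P.trans u⊑z z⊑x))
      ; levelClosed = λ z∈ u⊑z ρu≡ρz → let z⊑x , ρz≡ρx = ∈-select⁻ _ z∈ in
                                       ∈-select⁺ _ (≤P.trans u⊑z z⊑x , trans ρu≡ρz ρz≡ρx)
      })

    ≤Q⇒sameBlock : ∀ {x y} → x ∈ S Q → y ≤Q[ Q ] x → ρ y ≡ ρ x
    ≤Q⇒sameBlock {x} {y} x∈S y≤x =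
      proj₂ (∈-select⁻ _ (proj₂ (Slice-JQ (antitone-S x∈S)) y x (x∈Slice x) y≤x))

    ∉S⇒lower : ∀ {b} → b ∉ S Q → ∃ λ a → a ⊑ b × ρ a < ρ b
    ∉S⇒lower {b} b∉S with Fin.any? (λ a → (a ⊑? b) ×-dec (ρ a ℕ.<? ρ b))
    ... | yes lower = lower
    ... | no ¬lower = contradiction (proj₁ (Slice-JQ minimal) b (x∈Slice b)) b∉S
      where
      minimal : ∀ {u} → u ⊑ b → ρ b ≤ ρ u
      minimal {u} u⊑b = ℕ.≮⇒≥ λ ρu<ρb → ¬lower (u , u⊑b , ρu<ρb)

    ρ⁺ : Fin n → ℕ
    ρ⁺ x with x ∈? S Q
    ... | yes _ = ρ x
    ... | no _  = m Ψ + height P x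

    ρ⁺-S : ∀ {x} → x ∈ S Q → ρ⁺ x ≡ ρ x
    ρ⁺-S {x} x∈S with x ∈? S Q
    ... | yes _   = refl
    ... | no x∉S = contradiction x∈S x∉S

    ρ⁺-∉S : ∀ {x} → x ∉ S Q → ρ⁺ x ≡ m Ψ + height P x
    ρ⁺-∉S {x} x∉S with x ∈? S Q
    ... | yes x∈S = contradiction x∈S x∉S
    ... | no _    = refl

    ρ⁺-S<∉S : ∀ {x y} → x ∈ S Q → y ∉ S Q → ρ⁺ x < ρ⁺ y
    ρ⁺-S<∉S {x} {y} x∈S y∉S = subst₂ _<_ (sym (ρ⁺-S x∈S)) (sym (ρ⁺-∉S y∉S))
      (ℕ.<-≤-trans (Fin.toℕ<n (blk Ψ x)) (ℕ.m≤m+n (m Ψ) (height P y)))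

    ρ⁺-strict : ∀ {a b} → _<P_ P a b → b ∉ S Q → ρ⁺ a < ρ⁺ b
    ρ⁺-strict {a} {b} a<b b∉S with toSum (a ∈? S Q)
    ... | inj₁ a∈S = ρ⁺-S<∉S a∈S b∉S
    ... | inj₂ a∉S = subst₂ _<_ (sym (ρ⁺-∉S a∉S)) (sym (ρ⁺-∉S b∉S))
                       (ℕ.+-monoʳ-< (m Ψ) (height-strict P a<b))

    RankIdeal-ρ⁺⇒JQ : ∀ {X} → RankIdeal P ρ⁺ X → JQ Q X
    RankIdeal-ρ⁺⇒JQ {X} ideal = ⊆S , closed
      where
      ⊆S : ∀ x → x ∈ X → x ∈ S Q
      ⊆S x x∈X with toSum (x ∈? S Q)
      ... | inj₁ x∈S = x∈S
      ... | inj₂ x∉S with ∉S⇒lower x∉S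
      ...   | a , a⊑x , ρa<ρx = contradiction (antitone ideal x∈X a⊑x) (ℕ.<⇒≱ (ρ⁺-strict a<x x∉S))
        where
        a<x : _<P_ P a x
        a<x = a⊑x , λ { refl → ℕ.<-irrefl refl ρa<ρx }

      closed : ∀ y x → x ∈ X → y ≤Q[ Q ] x → y ∈ X
      closed y x x∈X y≤x@(y∈S , x∈S , _ , y⊑x) = levelClosed ideal x∈X y⊑x
        (trans (ρ⁺-S y∈S) (trans (≤Q⇒sameBlock x∈S y≤x) (sym (ρ⁺-S x∈S))))

    JQ⇒RankIdeal-ρ⁺ : ∀ {X} → JQ Q X → RankIdeal P ρ⁺ X
    JQ⇒RankIdeal-ρ⁺ {X} (⊆S , closed) = record { antitone = antitone′ ; levelClosed = levelClosed′ }
      where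
      antitone′ : ∀ {x y} → x ∈ X → y ⊑ x → ρ⁺ x ≤ ρ⁺ y
      antitone′ {x} {y} x∈X y⊑x with toSum (y ∈? S Q)
      ... | inj₁ y∈S = subst₂ _≤_ (sym (ρ⁺-S (⊆S x x∈X))) (sym (ρ⁺-S y∈S)) (antitone-S (⊆S x x∈X) y⊑x)
      ... | inj₂ y∉S = ℕ.<⇒≤ (ρ⁺-S<∉S (⊆S x x∈X) y∉S)

      levelClosed′ : ∀ {x y} → x ∈ X → y ⊑ x → ρ⁺ y ≡ ρ⁺ x → y ∈ X
      levelClosed′ {x} {y} x∈X y⊑x ρ⁺y≡ρ⁺x with toSum (y ∈? S Q)
      ... | inj₂ y∉S = contradiction (sym ρ⁺y≡ρ⁺x) (ℕ.<⇒≢ (ρ⁺-S<∉S (⊆S x x∈X) y∉S))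
      ... | inj₁ y∈S = closed y x x∈X (sameBlock⇒≤Q (⊆S x x∈X) y⊑x
                        (trans (sym (ρ⁺-S y∈S)) (trans ρ⁺y≡ρ⁺x (ρ⁺-S (⊆S x x∈X)))))

    JQ⇔RankIdeal-ρ⁺ : ∀ X → JQ Q X ⇔ RankIdeal P ρ⁺ X
    JQ⇔RankIdeal-ρ⁺ X = mk⇔ JQ⇒RankIdeal-ρ⁺ RankIdeal-ρ⁺⇒JQ

    module _ (Φ : SetComp n) (Φ∼ρ⁺ : SameOrder (blockIndex Φ) ρ⁺) where

      Supp-from-ρ⁺ : Supp Q Φ
      Supp-from-ρ⁺ X = ⇔.trans (μΔ-J⇔RankIdeal P Φ X)
                         (⇔.trans (RankIdeal-cong P Φ∼ρ⁺ X) (⇔.sym (JQ⇔RankIdeal-ρ⁺ X)))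

      respects-betrayals : ∀ (bt : Betrayal Q) b (b∉S : b ∉ S Q) → β bt b b∉S <[ Φ ] b
      respects-betrayals bt b b∉S = SameOrder-< Φ∼ρ⁺ {β bt b b∉S} {b} (ρ⁺-strict (β< bt b b∉S) b∉S)

-- Φ respects every betrayal function.
proposition4p14 : (n : ℕ) (P : FinPoset n) (Q : Fracturing P) → Good Q →
    ∃ λ (Φ : SetComp n) →
      Supp Q Φ × (∀ (bt : Betrayal Q) → (∃ λ Ψ → Suppβ Q bt Ψ) → Suppβ Q bt Φ)
proposition4p14 n P Q (Ψ , suppΨ) =
  let Φ , Φ∼ρ⁺ = compress ρ⁺
  in Φ , Supp-from-ρ⁺ Φ Φ∼ρ⁺ , λ bt _ → Supp-from-ρ⁺ Φ Φ∼ρ⁺ , respects-betrayals Φ Φ∼ρ⁺ bt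
  where open Support Q Ψ suppΨ
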